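{- For integers $k \ge r \ge 2$, $\beta_1(k,r) = 2(r-1)$.
   Context: A $k$-partite graph comes with a fixed partition of its vertex set into $k$ parts (parts may be empty). For $k \ge r \ge 2$ and $1 \le i \le k-r+1$, $\beta_i(k,r)$ is the minimum number of vertices of a $K_r$-free $k$-partite graph such that, for every choice of $k-i$ of its parts, the subgraph induced by those parts contains a $K_{r-1}$. -}

module Defs where

open import Level using (0ℓ)
open import Data.Nat using (ℕ; _≤_; _∸_)
open import Data.Fin using (Fin)
open import Data.Fin.Subset using (Subset; _∈_; ∣_∣)
open import Data.Product using (Σ; ∃; _×_)
open import Relation.Binary.PropositionalEquality using (_≡_; _≢_)
open import Relation.Nullary using (¬_)
open import Function.Definitions using (Injective)

record KPartiteGraph (k n : ℕ) : Set₁ where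
  field
    part   : Fin n → Fin k
    Adj    : Fin n → Fin n → Set
    sym    : ∀ {u v} → Adj u v → Adj v u
    irrefl : ∀ {v} → ¬ Adj v v
    proper : ∀ {u v} → Adj u v → part u ≢ part v

open KPartiteGraph public

CliqueIn : ∀ {k n} → KPartiteGraph k n → Subset k → ℕ → Set
CliqueIn {k} {n} G S r =
  Σ (Fin r → Fin n) λ f →
    Injective _≡_ _≡_ f ×
    (∀ i j → i ≢ j → Adj G (f i) (f j)) ×
    (∀ i → part G (f i) ∈ S)

HasClique : ∀ {k n} → KPartiteGraph k n → ℕ → Set
HasClique {k} G r = Σ (Subset k) λ S → CliqueIn G S r

KrFree : ∀ {k n} → KPartiteGraph k n → ℕ → Set
KrFree G r = ¬ HasClique G r

Admissible : (i k r : ℕ) → ∀ {n} → KPartiteGraph k n → Set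
Admissible i k r {n} G =
  KrFree G r × (∀ (S : Subset k) → ∣ S ∣ ≡ k ∸ i → CliqueIn G S (r ∸ 1))

Realizable : (i k r n : ℕ) → Set₁
Realizable i k r n = Σ (KPartiteGraph k n) (Admissible i k r)

IsBeta : (i k r m : ℕ) → Set₁
IsBeta i k r m = Realizable i k r m × (∀ n → Realizable i k r n → m ≤ n)

module Submission where

-- β₁(k, r) = 2(r − 1) for k ≥ r ≥ 2.  Write R = r − 1 ≥ 1.
--
-- Lower bound (a Hajnal-type counting argument).  In a K_{R+1}-free graph,
-- call a pair (I, U) of vertex sets a Hajnal pair if I ⊆ U, every vertex of I
-- is adjacent to every other vertex of U, and |I| + |U| ≥ 2R.  A clique K with
-- |K| ≥ R is a Hajnal pair (K, K), and such a clique K turns a Hajnal pair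
-- (I, U) into (I ∩ K, U ∪ K): the set I ∪ (U ∩ K) is a clique, hence has at
-- most R vertices, and the modular law |p ∩ q| + |p ∪ q| = |p| + |q| does the
-- rest.  In an admissible graph every vertex v is missed by the K_R living in
-- the parts other than the part of v; sweeping over all vertices empties I,
-- so the number of vertices is at least |U| ≥ 2R.
--
-- Upper bound.  On the vertices 0, …, 2R−1 put t into part t mod (R+1) and
-- join t ≠ t' when |t − t'| < R.  Two numbers closer than m with the same
-- residue mod m are equal; mod R+1 this makes the parts independent and shows
-- that a window of R consecutive vertices avoids a chosen part, and mod R
-- (by pigeonhole) it rules out a K_{R+1}.

open import Defs hiding (sym)
open import Data.Nat using (ℕ; zero; suc; _+_; _*_; _∸_; _≤_; _<_; _≤?_; _<?_; z≤n; s≤s; NonZero)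
open import Data.Nat.Properties
  using ( suc-injective; +-suc; +-assoc; +-comm; +-identityʳ; +-commutativeSemigroup
        ; ≤-reflexive; ≤-trans; <-≤-trans; <-cmp; <⇒≱; <⇒≢; ≰⇒>; n≤1+n; n<1+n
        ; m≤m+n; m≤n+m; m<n⇒m<1+n; m≢1+m+n
        ; +-mono-≤; +-monoˡ-≤; +-monoʳ-≤; +-monoʳ-<; +-mono-≤-<; *-monoˡ-≤
        ; +-cancelˡ-≡; +-cancelʳ-≤; module ≤-Reasoning )
open import Data.Nat.DivMod using (_%_; _/_; m≡m%n+[m/n]*n; m%n<n; m<n⇒m%n≡m)
open import Data.Fin using (Fin; zero; suc; toℕ; fromℕ<; inject≤)
open import Data.Fin.Properties
  using (toℕ<n; toℕ-fromℕ<; toℕ-injective; inject≤-injective; injective⇒≤; pigeonhole)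
import Data.Fin.Properties as Finₚ
open import Data.Fin.Subset
  using (Subset; inside; outside; _∈_; _∉_; _⊆_; ∣_∣; _∩_; _∪_; ∁; ⁅_⁆; ⊤; ⊥)
open import Data.Fin.Subset.Properties
  using ( x∈p∩q⁺; x∈p∩q⁻; x∈p∪q⁺; x∈p∪q⁻; x∈⁅x⁆; x∈⁅y⁆⇒x≡y; x≢y⇒x∉⁅y⁆
        ; x∈∁p⇒x∉p; x∉p⇒x∈∁p; ∉⊥; ∈⊤; Empty-unique
        ; ∣⊥∣≡0; ∣p∣≤n; ∣p∣≡n⇒p≡⊤; ∣⁅x⁆∣≡1; ∣∁p∣≡n∸∣p∣; p⊆q⇒∣p∣≤∣q∣ )
open import Data.Vec using (_∷_; []; here; there)
open import Data.List using (List; []; _∷_; allFin)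
open import Data.List.Relation.Unary.All as All using (All; []; _∷_)
open import Data.List.Membership.Propositional.Properties using (∈-allFin)
open import Data.Product using (∃; ∃₂; _×_; _,_; proj₁; proj₂)
open import Data.Sum using (inj₁; inj₂)
open import Data.Empty using (⊥-elim)
open import Relation.Nullary using (yes; no)
open import Relation.Nullary.Negation using (contradiction)
open import Relation.Binary using (tri<; tri≈; tri>)
open import Relation.Binary.PropositionalEquality using (_≡_; _≢_; refl; sym; trans; cong; cong₂; subst; module ≡-Reasoning)
open import Function using (_∘_)
open import Function.Definitions using (Injective)
open import Algebra.Properties.CommutativeSemigroup +-commutativeSemigroup using (interchange)

same-residue-gap : ∀ m .{{_ : NonZero m}} a b → a % m ≡ b % m → a / m < b / m → a + m ≤ b
same-residue-gap m a b same lt = begin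
  a + m                      ≡⟨ cong (_+ m) (m≡m%n+[m/n]*n a m) ⟩
  a % m + a / m * m + m      ≡⟨ +-assoc (a % m) (a / m * m) m ⟩
  a % m + (a / m * m + m)    ≡⟨ cong (a % m +_) (+-comm (a / m * m) m) ⟩
  a % m + suc (a / m) * m    ≤⟨ +-mono-≤ (≤-reflexive same) (*-monoˡ-≤ m lt) ⟩
  b % m + b / m * m          ≡⟨ m≡m%n+[m/n]*n b m ⟨
  b                          ∎
  where open ≤-Reasoning

-- Two numbers at distance less than m with the same residue mod m are equal.
-- This one fact gives both properness and K_{R+1}-freeness of the construction.
same-residue-close : ∀ m .{{_ : NonZero m}} a b → a % m ≡ b % m → a < b + m → b < a + m → a ≡ b
same-residue-close m a b same a<b+m b<a+m with <-cmp (a / m) (b / m)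
... | tri< lt _ _ = contradiction (same-residue-gap m a b same lt) (<⇒≱ b<a+m)
... | tri> _ _ gt = contradiction (same-residue-gap m b a (sym same) gt) (<⇒≱ a<b+m)
... | tri≈ _ eq _ = begin
  a                  ≡⟨ m≡m%n+[m/n]*n a m ⟩
  a % m + a / m * m  ≡⟨ cong₂ (λ ρ q → ρ + q * m) same eq ⟩
  b % m + b / m * m  ≡⟨ m≡m%n+[m/n]*n b m ⟨
  b                  ∎
  where open ≡-Reasoning

∣p∩q∣+∣p∪q∣≡∣p∣+∣q∣ : ∀ {n} (p q : Subset n) → ∣ p ∩ q ∣ + ∣ p ∪ q ∣ ≡ ∣ p ∣ + ∣ q ∣
∣p∩q∣+∣p∪q∣≡∣p∣+∣q∣ [] [] = refl
∣p∩q∣+∣p∪q∣≡∣p∣+∣q∣ (inside ∷ p) (inside ∷ q) =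
  cong suc (trans (+-suc _ _) (trans (cong suc (∣p∩q∣+∣p∪q∣≡∣p∣+∣q∣ p q)) (sym (+-suc _ _))))
∣p∩q∣+∣p∪q∣≡∣p∣+∣q∣ (inside ∷ p) (outside ∷ q) =
  trans (+-suc _ _) (cong suc (∣p∩q∣+∣p∪q∣≡∣p∣+∣q∣ p q))
∣p∩q∣+∣p∪q∣≡∣p∣+∣q∣ (outside ∷ p) (inside ∷ q) =
  trans (+-suc _ _) (trans (cong suc (∣p∩q∣+∣p∪q∣≡∣p∣+∣q∣ p q)) (sym (+-suc _ _)))
∣p∩q∣+∣p∪q∣≡∣p∣+∣q∣ (outside ∷ p) (outside ∷ q) = ∣p∩q∣+∣p∪q∣≡∣p∣+∣q∣ p q

element : ∀ {n} (p : Subset n) → Fin ∣ p ∣ → Fin n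
element (inside ∷ p) zero = zero
element (inside ∷ p) (suc i) = suc (element p i)
element (outside ∷ p) i = suc (element p i)

element-∈ : ∀ {n} (p : Subset n) i → element p i ∈ p
element-∈ (inside ∷ p) zero = here
element-∈ (inside ∷ p) (suc i) = there (element-∈ p i)
element-∈ (outside ∷ p) i = there (element-∈ p i)

element-injective : ∀ {n} (p : Subset n) → Injective _≡_ _≡_ (element p)
element-injective (inside ∷ p) {zero} {zero} _ = refl
element-injective (inside ∷ p) {suc i} {suc j} eq = cong suc (element-injective p (Finₚ.suc-injective eq))
element-injective (outside ∷ p) eq = element-injective p (Finₚ.suc-injective eq)

index : ∀ {n} {p : Subset n} {x} → x ∈ p → Fin ∣ p ∣
index here = zero
index {p = inside ∷ _} (there x∈p) = suc (index x∈p)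
index {p = outside ∷ _} (there x∈p) = index x∈p

element-index : ∀ {n} {p : Subset n} {x} (x∈p : x ∈ p) → element p (index x∈p) ≡ x
element-index here = refl
element-index {p = inside ∷ _} (there x∈p) = cong suc (element-index x∈p)
element-index {p = outside ∷ _} (there x∈p) = cong suc (element-index x∈p)

injection⇒≤∣p∣ : ∀ {m n} {p : Subset n} (f : Fin m → Fin n) → Injective _≡_ _≡_ f → (∀ i → f i ∈ p) → m ≤ ∣ p ∣
injection⇒≤∣p∣ {p = p} f f-inj f∈p = injective⇒≤ index∘f-injective
  where
  index∘f-injective : Injective _≡_ _≡_ (λ i → index (f∈p i))
  index∘f-injective {i} {j} eq = f-inj (begin
    f i                       ≡⟨ element-index (f∈p i) ⟨
    element p (index (f∈p i)) ≡⟨ cong (element p) eq ⟩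
    element p (index (f∈p j)) ≡⟨ element-index (f∈p j) ⟩
    f j                       ∎)
    where open ≡-Reasoning

image : ∀ {m n} → (Fin m → Fin n) → Subset n
image {zero} f = ⊥
image {suc m} f = ⁅ f zero ⁆ ∪ image (f ∘ suc)

∈-image : ∀ {m n} (f : Fin m → Fin n) i → f i ∈ image f
∈-image f zero = x∈p∪q⁺ (inj₁ (x∈⁅x⁆ (f zero)))
∈-image f (suc i) = x∈p∪q⁺ (inj₂ (∈-image (f ∘ suc) i))

image-∈ : ∀ {m n} (f : Fin m → Fin n) {x} → x ∈ image f → ∃ λ i → f i ≡ x
image-∈ {zero} f x∈ = ⊥-elim (∉⊥ x∈)
image-∈ {suc m} f x∈ with x∈p∪q⁻ ⁅ f zero ⁆ (image (f ∘ suc)) x∈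
... | inj₁ x∈⁅f0⁆ = zero , sym (x∈⁅y⁆⇒x≡y (f zero) x∈⁅f0⁆)
... | inj₂ x∈rest with image-∈ (f ∘ suc) x∈rest
...   | i , eq = suc i , eq

∣p∣≡k⇒∁⁅j⁆⊆p : ∀ {k} (p : Subset (suc k)) → ∣ p ∣ ≡ k → ∃ λ j → ∁ ⁅ j ⁆ ⊆ p
∣p∣≡k⇒∁⁅j⁆⊆p (outside ∷ p) full = zero , λ { (there _) → there (subst (_ ∈_) (sym (∣p∣≡n⇒p≡⊤ full)) ∈⊤) }
∣p∣≡k⇒∁⁅j⁆⊆p {zero} (inside ∷ []) ()
∣p∣≡k⇒∁⁅j⁆⊆p {suc k} (inside ∷ p) e with ∣p∣≡k⇒∁⁅j⁆⊆p p (suc-injective e)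
... | j , ∁⁅j⁆⊆p = suc j , λ { here → here ; (there x∈) → there (∁⁅j⁆⊆p x∈) }

-- Cliques as vertex sets: p is pairwise adjacent.  CliqueIn (an injective
-- labelled copy of K_m) is converted to and from this set-based notion.
IsClique : ∀ {k n} → KPartiteGraph k n → Subset n → Set
IsClique G p = ∀ {x y} → x ∈ p → y ∈ p → x ≢ y → Adj G x y

module _ {k n} (G : KPartiteGraph k n) where

  vertex-set-clique : ∀ {S m} (C : CliqueIn G S m) → IsClique G (image (proj₁ C))
  vertex-set-clique (f , _ , f-adj , _) x∈ y∈ x≢y with image-∈ f x∈ | image-∈ f y∈
  ... | i , refl | j , refl = f-adj i j (λ i≡j → x≢y (cong f i≡j))

  vertex-set-size : ∀ {S m} (C : CliqueIn G S m) → m ≤ ∣ image (proj₁ C) ∣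
  vertex-set-size (f , f-inj , _ , _) = injection⇒≤∣p∣ f f-inj (∈-image f)

  vertex-set-parts : ∀ {S m} (C : CliqueIn G S m) {x} → x ∈ image (proj₁ C) → part G x ∈ S
  vertex-set-parts (f , _ , _ , f-parts) x∈ with image-∈ f x∈
  ... | i , refl = f-parts i

  clique-set⇒CliqueIn : ∀ {p m} → IsClique G p → m ≤ ∣ p ∣ → CliqueIn G ⊤ m
  clique-set⇒CliqueIn {p} p-clique m≤∣p∣ = f , f-inj , f-adj , λ _ → ∈⊤
    where
    f : Fin _ → Fin n
    f i = element p (inject≤ i m≤∣p∣)
    f-inj : Injective _≡_ _≡_ f
    f-inj eq = inject≤-injective m≤∣p∣ m≤∣p∣ _ _ (element-injective p eq)
    f-adj : ∀ i j → i ≢ j → Adj G (f i) (f j)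
    f-adj i j i≢j = p-clique (element-∈ p _) (element-∈ p _) (λ eq → i≢j (f-inj eq))

-- The arithmetic of one Hajnal step, with a = |I|, b = |U|, c = |K|,
-- u = |U ∪ K|, x = |I ∩ K|, y = |U ∩ K|, z = |I ∪ (U ∩ K)|, w = |I ∩ (U ∩ K)|:
-- the two modular laws, w ≤ x, z ≤ R (clique bound) and R ≤ c give
-- x + u ≥ a + b.
hajnal-count : ∀ {R a b c u w x y z} → y + u ≡ b + c → w + z ≡ a + y →
               w ≤ x → z ≤ R → R ≤ c → R + R ≤ a + b → R + R ≤ x + u
hajnal-count {R} {a} {b} {c} {u} {w} {x} {y} {z} yu≡bc wz≡ay w≤x z≤R R≤c 2R≤ab =
  +-cancelʳ-≤ (y + R) (R + R) (x + u) (begin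
  (R + R) + (y + R)  ≤⟨ +-monoˡ-≤ (y + R) 2R≤ab ⟩
  (a + b) + (y + R)  ≡⟨ interchange a b y R ⟩
  (a + y) + (b + R)  ≡⟨ cong (_+ (b + R)) wz≡ay ⟨
  (w + z) + (b + R)  ≤⟨ +-mono-≤ (+-mono-≤ w≤x z≤R) (+-monoʳ-≤ b R≤c) ⟩
  (x + R) + (b + c)  ≡⟨ cong ((x + R) +_) (trans (+-comm u y) yu≡bc) ⟨
  (x + R) + (u + y)  ≡⟨ interchange x R u y ⟩
  (x + u) + (R + y)  ≡⟨ cong ((x + u) +_) (+-comm R y) ⟩
  (x + u) + (y + R)  ∎)
  where open ≤-Reasoning

module Hajnal {k n} (G : KPartiteGraph k n) (R : ℕ) (free : KrFree G (suc R)) where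

  clique-bound : ∀ {p} → IsClique G p → ∣ p ∣ ≤ R
  clique-bound {p} p-clique with ∣ p ∣ ≤? R
  ... | yes ∣p∣≤R = ∣p∣≤R
  ... | no ∣p∣≰R = contradiction (⊤ , clique-set⇒CliqueIn G p-clique (≰⇒> ∣p∣≰R)) free

  Large : Subset n → Set
  Large K = IsClique G K × R ≤ ∣ K ∣

  record HajnalPair (I U : Subset n) : Set where
    field
      I⊆U     : I ⊆ U
      I-adj-U : ∀ {x y} → x ∈ I → y ∈ U → x ≢ y → Adj G x y
      2R≤     : R + R ≤ ∣ I ∣ + ∣ U ∣
  open HajnalPair

  start : ∀ {K} → Large K → HajnalPair K K
  start (K-clique , R≤∣K∣) = record
    { I⊆U = λ x∈ → x∈ ; I-adj-U = K-clique ; 2R≤ = +-mono-≤ R≤∣K∣ R≤∣K∣ }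

  extend : ∀ {I U K} → HajnalPair I U → Large K → HajnalPair (I ∩ K) (U ∪ K)
  extend {I} {U} {K} h (K-clique , R≤∣K∣) = record { I⊆U = I∩K⊆U∪K ; I-adj-U = adj ; 2R≤ = count }
    where
    I∩K⊆U∪K : I ∩ K ⊆ U ∪ K
    I∩K⊆U∪K x∈ = x∈p∪q⁺ (inj₁ (I⊆U h (proj₁ (x∈p∩q⁻ I K x∈))))
    adj : ∀ {x y} → x ∈ I ∩ K → y ∈ U ∪ K → x ≢ y → Adj G x y
    adj x∈ y∈ with x∈p∩q⁻ I K x∈ | x∈p∪q⁻ U K y∈
    ... | x∈I , _   | inj₁ y∈U = I-adj-U h x∈I y∈U
    ... | _   , x∈K | inj₂ y∈K = K-clique x∈K y∈K
    -- Z = I ∪ (U ∩ K) is a clique: this is where K_{R+1}-freeness enters.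
    Z-clique : IsClique G (I ∪ (U ∩ K))
    Z-clique x∈ y∈ x≢y with x∈p∪q⁻ I (U ∩ K) x∈ | x∈p∪q⁻ I (U ∩ K) y∈
    ... | inj₁ x∈I | inj₁ y∈I = I-adj-U h x∈I (I⊆U h y∈I) x≢y
    ... | inj₁ x∈I | inj₂ y∈UK = I-adj-U h x∈I (proj₁ (x∈p∩q⁻ U K y∈UK)) x≢y
    ... | inj₂ x∈UK | inj₁ y∈I = KPartiteGraph.sym G (I-adj-U h y∈I (proj₁ (x∈p∩q⁻ U K x∈UK)) (x≢y ∘ sym))
    ... | inj₂ x∈UK | inj₂ y∈UK = K-clique (proj₂ (x∈p∩q⁻ U K x∈UK)) (proj₂ (x∈p∩q⁻ U K y∈UK)) x≢y
    I∩UK⊆I∩K : I ∩ (U ∩ K) ⊆ I ∩ K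
    I∩UK⊆I∩K x∈ with x∈p∩q⁻ I (U ∩ K) x∈
    ... | x∈I , x∈UK = x∈p∩q⁺ (x∈I , proj₂ (x∈p∩q⁻ U K x∈UK))
    count : R + R ≤ ∣ I ∩ K ∣ + ∣ U ∪ K ∣
    count = hajnal-count (∣p∩q∣+∣p∪q∣≡∣p∣+∣q∣ U K) (∣p∩q∣+∣p∪q∣≡∣p∣+∣q∣ I (U ∩ K))
      (p⊆q⇒∣p∣≤∣q∣ I∩UK⊆I∩K) (clique-bound Z-clique) R≤∣K∣ (2R≤ h)

  missed⇒2R≤n : ∀ {K₀} → Large K₀ → (K : Fin n → Subset n) →
                (∀ v → Large (K v) × v ∉ K v) → R + R ≤ n
  missed⇒2R≤n {K₀} large₀ K K-misses = bound (sweep (allFin n))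
    where
    sweep : (vs : List (Fin n)) → ∃₂ λ I U → HajnalPair I U × All (_∉ I) vs
    sweep [] = K₀ , K₀ , start large₀ , []
    sweep (v ∷ vs) with sweep vs
    ... | I , U , h , vs∉I = I ∩ K v , U ∪ K v , extend h (proj₁ (K-misses v)) ,
          (λ v∈ → proj₂ (K-misses v) (proj₂ (x∈p∩q⁻ I (K v) v∈))) ∷
          All.map (λ x∉I x∈ → x∉I (proj₁ (x∈p∩q⁻ I (K v) x∈))) vs∉I
    bound : (∃₂ λ I U → HajnalPair I U × All (_∉ I) (allFin n)) → R + R ≤ n
    bound (I , U , h , all∉I) = begin
      R + R              ≤⟨ 2R≤ h ⟩
      ∣ I ∣ + ∣ U ∣      ≡⟨ cong (λ p → ∣ p ∣ + ∣ U ∣) I≡⊥ ⟩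
      ∣ ⊥ {n} ∣ + ∣ U ∣  ≡⟨ cong (_+ ∣ U ∣) (∣⊥∣≡0 n) ⟩
      ∣ U ∣              ≤⟨ ∣p∣≤n U ⟩
      n                  ∎
      where
      open ≤-Reasoning
      I≡⊥ : I ≡ ⊥
      I≡⊥ = Empty-unique λ { (x , x∈I) → All.lookup all∉I (∈-allFin x) x∈I }

co-singleton-size : ∀ {k} (j : Fin (suc k)) → ∣ ∁ ⁅ j ⁆ ∣ ≡ k
co-singleton-size {k} j = trans (∣∁p∣≡n∸∣p∣ ⁅ j ⁆) (cong (suc k ∸_) (∣⁅x⁆∣≡1 j))

-- Lower bound: an admissible graph for β₁(k+1, R+1) has at least 2R vertices,
-- since each vertex v is missed by the K_R living outside the part of v.
admissible⇒2R≤n : ∀ {k n R} (G : KPartiteGraph (suc k) n) → Admissible 1 (suc k) (suc R) G → R + R ≤ n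
admissible⇒2R≤n {k} {R = R} G (free , cliques) =
  missed⇒2R≤n (large (cliques-avoiding zero)) (λ v → image (proj₁ (cliques-avoiding (part G v))))
    λ v → large (cliques-avoiding (part G v)) , misses v
  where
  open Hajnal G R free
  cliques-avoiding : (j : Fin (suc k)) → CliqueIn G (∁ ⁅ j ⁆) R
  cliques-avoiding j = cliques (∁ ⁅ j ⁆) (co-singleton-size j)
  large : ∀ {S} (C : CliqueIn G S R) → Large (image (proj₁ C))
  large C = vertex-set-clique G C , vertex-set-size G C
  misses : ∀ v → v ∉ image (proj₁ (cliques-avoiding (part G v)))
  misses v v∈ = x∈∁p⇒x∉p (vertex-set-parts G (cliques-avoiding (part G v)) v∈) (x∈⁅x⁆ (part G v))

2*R≡R+R : ∀ R → 2 * R ≡ R + R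
2*R≡R+R R = cong (R +_) (+-identityʳ R)

module IntervalGraph (R k : ℕ) .{{_ : NonZero R}} (R≤k : R ≤ k) where

  Near : ℕ → ℕ → Set
  Near a b = a < b + R × b < a + R

  part-of : Fin (2 * R) → Fin (suc k)
  part-of v = fromℕ< (<-≤-trans (m%n<n (toℕ v) (suc R)) (s≤s R≤k))

  toℕ-part-of : ∀ v → toℕ (part-of v) ≡ toℕ v % suc R
  toℕ-part-of v = toℕ-fromℕ< _

  near-same-part⇒≡ : ∀ {u v} → Near (toℕ u) (toℕ v) → part-of u ≡ part-of v → u ≡ v
  near-same-part⇒≡ {u} {v} (u<v+R , v<u+R) same-part = toℕ-injective
    (same-residue-close (suc R) (toℕ u) (toℕ v) same-residue (widen u<v+R) (widen v<u+R))
    where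
    widen : ∀ {a b} → a < b + R → a < b + suc R
    widen {b = b} a<b+R = <-≤-trans a<b+R (+-monoʳ-≤ b (n≤1+n R))
    same-residue : toℕ u % suc R ≡ toℕ v % suc R
    same-residue = trans (sym (toℕ-part-of u)) (trans (cong toℕ same-part) (toℕ-part-of v))

  graph : KPartiteGraph (suc k) (2 * R)
  graph = record
    { part   = part-of
    ; Adj    = λ u v → u ≢ v × Near (toℕ u) (toℕ v)
    ; sym    = λ { (u≢v , u<v+R , v<u+R) → u≢v ∘ sym , v<u+R , u<v+R }
    ; irrefl = λ { (v≢v , _) → v≢v refl }
    ; proper = λ { (u≢v , near) same-part → u≢v (near-same-part⇒≡ near same-part) }
    }

  -- Among R + 1 pairwise near vertices two agree mod R (pigeonhole), hence coincide.
  free : KrFree graph (suc R)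
  free (_ , f , _ , f-adj , _) =
    let i , j , i<j , same = pigeonhole (n<1+n R) residue
        fi≢fj , fi<fj+R , fj<fi+R = f-adj i j (<⇒≢ i<j ∘ cong toℕ)
    in fi≢fj (toℕ-injective (same-residue-close R _ _ (residue-≡ same) fi<fj+R fj<fi+R))
    where
    residue : Fin (suc R) → Fin R
    residue i = fromℕ< (m%n<n (toℕ (f i)) R)
    residue-≡ : ∀ {i j} → residue i ≡ residue j → toℕ (f i) % R ≡ toℕ (f j) % R
    residue-≡ eq = trans (sym (toℕ-fromℕ< _)) (trans (cong toℕ eq) (toℕ-fromℕ< _))

  window : ∀ s → s ≤ R → Fin R → Fin (2 * R)
  window s s≤R i = fromℕ< (subst (s + toℕ i <_) (sym (2*R≡R+R R)) (+-mono-≤-< s≤R (toℕ<n i)))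

  toℕ-window : ∀ s (s≤R : s ≤ R) i → toℕ (window s s≤R i) ≡ s + toℕ i
  toℕ-window s s≤R i = toℕ-fromℕ< _

  window-CliqueIn : ∀ {S} s (s≤R : s ≤ R) → (∀ i → part-of (window s s≤R i) ∈ S) → CliqueIn graph S R
  window-CliqueIn s s≤R parts∈S = window s s≤R , w-inj , w-adj , parts∈S
    where
    w-inj : Injective _≡_ _≡_ (window s s≤R)
    w-inj {i} {j} eq = toℕ-injective (+-cancelˡ-≡ s _ _
      (trans (sym (toℕ-window s s≤R i)) (trans (cong toℕ eq) (toℕ-window s s≤R j))))
    near : ∀ i j → toℕ (window s s≤R i) < toℕ (window s s≤R j) + R
    near i j rewrite toℕ-window s s≤R i | toℕ-window s s≤R j | +-assoc s (toℕ j) R =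
      +-monoʳ-< s (<-≤-trans (toℕ<n i) (m≤n+m R (toℕ j)))
    w-adj : ∀ i j → i ≢ j → Adj graph (window s s≤R i) (window s s≤R j)
    w-adj i j i≢j = i≢j ∘ w-inj , near i j , near j i

  -- For every part j some window misses residue j: start right after j if
  -- j < R, and at 0 otherwise.
  window-avoids : (j : Fin (suc k)) → ∃ λ s → s ≤ R × ∀ (i : Fin R) → (s + toℕ i) % suc R ≢ toℕ j
  window-avoids j with toℕ j <? R
  ... | yes j<R = suc (toℕ j) , j<R , λ i same → m≢1+m+n (toℕ j)
          (sym (same-residue-close (suc R) _ _ (trans same (sym (m<n⇒m%n≡m (m<n⇒m<1+n j<R)))) (below i) (above i)))
    where
    below : ∀ (i : Fin R) → suc (toℕ j) + toℕ i < toℕ j + suc R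
    below i = subst (suc (toℕ j + toℕ i) <_) (sym (+-suc (toℕ j) R)) (s≤s (+-monoʳ-< (toℕ j) (toℕ<n i)))
    above : ∀ (i : Fin R) → toℕ j < suc (toℕ j) + toℕ i + suc R
    above i = <-≤-trans (n<1+n (toℕ j)) (≤-trans (m≤m+n (suc (toℕ j)) (toℕ i)) (m≤m+n _ (suc R)))
  ... | no j≮R = 0 , z≤n , λ i same →
          j≮R (subst (_< R) (trans (sym (m<n⇒m%n≡m (m<n⇒m<1+n (toℕ<n i)))) same) (toℕ<n i))

  cliques : ∀ (S : Subset (suc k)) → ∣ S ∣ ≡ k → CliqueIn graph S R
  cliques S ∣S∣≡k with ∣p∣≡k⇒∁⁅j⁆⊆p S ∣S∣≡k
  ... | j , ∁⁅j⁆⊆S with window-avoids j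
  ...   | s , s≤R , avoids = window-CliqueIn s s≤R λ i →
            ∁⁅j⁆⊆S (x∉p⇒x∈∁p (x≢y⇒x∉⁅y⁆ λ same-part → avoids i (begin
              (s + toℕ i) % suc R                   ≡⟨ cong (_% suc R) (toℕ-window s s≤R i) ⟨
              toℕ (window s s≤R i) % suc R          ≡⟨ toℕ-part-of (window s s≤R i) ⟨
              toℕ (part-of (window s s≤R i))        ≡⟨ cong toℕ same-part ⟩
              toℕ j                                 ∎)))
    where open ≡-Reasoning

  admissible : Admissible 1 (suc k) (suc R) graph
  admissible = free , cliques

proposition3p8 : ∀ (k r : ℕ) → 2 ≤ r → r ≤ k → IsBeta 1 k r (2 * (r ∸ 1))
proposition3p8 k zero () _
proposition3p8 k (suc zero) (s≤s ()) _
proposition3p8 zero (suc (suc R)) _ ()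
proposition3p8 (suc k) (suc (suc R)) _ (s≤s R+1≤k) =
  (graph , admissible) ,
  λ n (G , G-admissible) → subst (_≤ n) (sym (2*R≡R+R (suc R))) (admissible⇒2R≤n G G-admissible)
  where open IntervalGraph (suc R) k R+1≤k
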